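{- Let $D$ be a finite simple digraph with $\gamma_I(D)\geq 3$. Let $F$ be an $r_I(D)$-set, and let $g$ be an Italian dominating function of $D+F$ of minimum weight $\gamma_I(D+F)$. Then: (i) for each arc $v_1v_2\in F$, $g(v_1)\neq 0$ and $g(v_2)=0$; (ii) $\gamma_I(D+F)=\gamma_I(D)-1$.
   Context: A finite simple digraph has no loops and no multiple arcs (oppositely oriented arcs allowed). An Italian dominating function (IDF) on $D$ is a function $f:V(D)\to\{0,1,2\}$ such that every vertex $v$ with $f(v)=0$ has at least two in-neighbors $w$ with $f(w)=1$ or at least one in-neighbor $w$ with $f(w)=2$; its weight is $\sum_u f(u)$ and $\gamma_I(D)$ is the minimum weight of an IDF. For a set $R$ of ordered pairs of distinct vertices not in $A(D)$ (arcs of the complement $\overline{D}$), $D+R$ is the digraph obtained by adding these arcs. Such $R$ is an Italian reinforcement set (IRS) of $D$ if $\gamma_I(D+R)<\gamma_I(D)$. The Italian reinforcement number $r_I(D)$ is the minimum size of an IRS (defined to be $0$ if $\gamma_I(D)\le 2$), and an $r_I(D)$-set is an IRS of size $r_I(D)$. -}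

module Defs where

open import Data.Nat using (ℕ; _+_; _≤_; _<_)
open import Data.Fin using (Fin)
open import Data.List using (List; map; allFin; length)
open import Data.Nat.ListAction using (sum)
open import Data.List.Membership.Propositional using (_∈_)
open import Data.List.Relation.Unary.All using (All)
open import Data.List.Relation.Unary.Unique.Propositional using (Unique)
open import Data.Product using (Σ; _×_; _,_; ∃; ∃-syntax)
open import Data.Sum using (_⊎_)
open import Relation.Nullary using (¬_)
open import Relation.Binary.PropositionalEquality using (_≡_; _≢_)

-- No loops; since Arc is a
-- relation (not a multiset), there are no multiple arcs; oppositely
-- oriented arcs are allowed.
record Digraph (n : ℕ) : Set₁ where
  field
    Arc   : Fin n → Fin n → Set
    loopless : ∀ v → ¬ Arc v v
open Digraph public

weight : ∀ {n} → (Fin n → ℕ) → ℕ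
weight {n} f = sum (map f (allFin n))

IsIDF : ∀ {n} → Digraph n → (Fin n → ℕ) → Set
IsIDF {n} D f =
  (∀ v → f v ≤ 2) ×
  (∀ v → f v ≡ 0 →
     (∃[ w ] (Arc D w v × f w ≡ 2)) ⊎
     (∃[ w₁ ] ∃[ w₂ ] (w₁ ≢ w₂ × Arc D w₁ v × Arc D w₂ v × f w₁ ≡ 1 × f w₂ ≡ 1)))

IsMinIDF : ∀ {n} → Digraph n → (Fin n → ℕ) → Set
IsMinIDF D f = IsIDF D f × (∀ h → IsIDF D h → weight f ≤ weight h)

IsγI : ∀ {n} → Digraph n → ℕ → Set
IsγI D k = ∃[ f ] (IsMinIDF D f × weight f ≡ k)

IsComplementArcSet : ∀ {n} → Digraph n → List (Fin n × Fin n) → Set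
IsComplementArcSet D R =
  Unique R × All (λ p → (Σ.proj₁ p ≢ Σ.proj₂ p) × ¬ Arc D (Σ.proj₁ p) (Σ.proj₂ p)) R

_+A_ : ∀ {n} → (D : Digraph n) → (R : List (Fin n × Fin n)) →
       IsComplementArcSet D R → Digraph n
(D +A R) (_ , okR) = record
  { Arc = λ u v → Arc D u v ⊎ (u , v) ∈ R
  ; loopless = λ v → loopless' v
  }
  where
  open import Data.Sum using (inj₁; inj₂)
  open import Data.List.Membership.Propositional.Properties using ()
  open import Data.List.Relation.Unary.All using (lookup)
  open import Data.Product using (proj₁)
  loopless' : ∀ v → ¬ (Arc D v v ⊎ (v , v) ∈ R)
  loopless' v (inj₁ a) = loopless D v a
  loopless' v (inj₂ m) = proj₁ (lookup okR m) _≡_.refl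

IsIRS : ∀ {n} → Digraph n → List (Fin n × Fin n) → Set
IsIRS D R = Σ (IsComplementArcSet D R) λ ok →
  ∃[ k ] ∃[ k' ] (IsγI D k × IsγI ((D +A R) ok) k' × k' < k)

-- F is an r_I(D)-set: an IRS of minimum size.
-- (Only used when γ_I(D) ≥ 3, where r_I(D) is the minimum size of an IRS.)
IsRISet : ∀ {n} → Digraph n → List (Fin n × Fin n) → Set
IsRISet D F = IsIRS D F × (∀ R → IsIRS D R → length F ≤ length R)

-- Removing an arc p from an r_I(D)-set F leaves a shorter set, which by minimality of F
-- admits no IDF lighter than γ_I(D).  A minimum IDF g of D + F therefore must use every
-- arc of F (its tail is labelled nonzero, its head 0), otherwise g would already be an
-- IDF of D + (F ∖ p).  Raising g at the head of p from 0 to 1 makes p superfluous, so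
-- γ_I(D) ≤ weight g + 1, while weight g < γ_I(D) since F reinforces.

module Submission where

open import Defs
open import Data.Nat using (ℕ; zero; suc; _+_; _≤_; _<_; z≤n; s≤s)
open import Data.Nat.Properties
  using (_≟_; ≤-refl; ≤-trans; ≤-antisym; ≤-pred; ≤-<-trans; ≤-reflexive; <⇒≱; ≮⇒≥;
         n≤0⇒n≡0; +-suc; +-comm)
open import Data.Fin using (Fin; zero; suc)
import Data.Fin.Properties as Fin
open import Data.List using (List; []; _∷_; filter; length)
open import Data.List.Properties using (map-tabulate; filter-notAll)
open import Data.List.Membership.Propositional using (_∈_)
open import Data.List.Membership.Propositional.Properties using (∈-filter⁺)
open import Data.List.Relation.Unary.Any as Any using ()
import Data.List.Relation.Unary.All.Properties as All
import Data.List.Relation.Unary.Unique.Propositional.Properties as Unique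
open import Data.Nat.ListAction using (sum)
open import Data.Product using (_×_; _,_; proj₁; proj₂; ∃; ∃-syntax)
open import Data.Product.Properties using (≡-dec)
open import Data.Sum using (_⊎_; inj₁; inj₂)
open import Data.Vec.Functional using (updateAt)
open import Data.Vec.Functional.Properties using (updateAt-updates; updateAt-minimal)
open import Function using (id; _∘_)
open import Relation.Nullary using (¬_; Dec; yes; no; ¬?)
open import Relation.Nullary.Decidable using (decidable-stable; ¬¬-excluded-middle)
open import Relation.Nullary.Negation using (¬¬-map; contradiction)
open import Relation.Binary.PropositionalEquality
  using (_≡_; _≢_; refl; sym; trans; cong; subst; subst₂; module ≡-Reasoning)

private
  variable
    n k : ℕ

weight-suc : (f : Fin (suc n) → ℕ) → weight f ≡ f zero + weight (f ∘ suc)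
weight-suc f =
  cong (f zero +_) (cong sum (trans (map-tabulate suc f) (sym (map-tabulate id (f ∘ suc)))))

weight-updateAt-suc : (f : Fin n → ℕ) (v : Fin n) → weight (updateAt f v suc) ≡ suc (weight f)
weight-updateAt-suc f zero = begin
  weight (updateAt f zero suc)     ≡⟨ weight-suc (updateAt f zero suc) ⟩
  suc (f zero + weight (f ∘ suc))  ≡⟨ cong suc (sym (weight-suc f)) ⟩
  suc (weight f)                   ∎
  where open ≡-Reasoning
weight-updateAt-suc f (suc v) = begin
  weight (updateAt f (suc v) suc)             ≡⟨ weight-suc (updateAt f (suc v) suc) ⟩
  f zero + weight (updateAt (f ∘ suc) v suc)  ≡⟨ cong (f zero +_) (weight-updateAt-suc (f ∘ suc) v) ⟩
  f zero + suc (weight (f ∘ suc))             ≡⟨ +-suc (f zero) (weight (f ∘ suc)) ⟩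
  suc (f zero + weight (f ∘ suc))             ≡⟨ cong suc (sym (weight-suc f)) ⟩
  suc (weight f)                              ∎
  where open ≡-Reasoning

IsItalianDominated : Digraph n → (Fin n → ℕ) → Fin n → Set
IsItalianDominated E f v =
  (∃[ w ] (Arc E w v × f w ≡ 2)) ⊎
  (∃[ w₁ ] ∃[ w₂ ] (w₁ ≢ w₂ × Arc E w₁ v × Arc E w₂ v × f w₁ ≡ 1 × f w₂ ≡ 1))

one-or-two : ∀ {m} → 1 ≤ m → m ≤ 2 → m ≡ 1 ⊎ m ≡ 2
one-or-two (s≤s z≤n) (s≤s z≤n)       = inj₁ refl
one-or-two (s≤s z≤n) (s≤s (s≤s z≤n)) = inj₂ refl

IsIDF-mono : ∀ (E : Digraph n) {f h} → IsIDF E f →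
             (∀ v → f v ≤ h v) → (∀ v → h v ≤ 2) → IsIDF E h
IsIDF-mono E {f} {h} (_ , dominated) f≤h h≤2 =
  h≤2 , λ v hv≡0 → raise (dominated v (n≤0⇒n≡0 (subst (f v ≤_) hv≡0 (f≤h v))))
  where
  h≥ : ∀ {w m} → f w ≡ m → m ≤ h w
  h≥ {w} refl = f≤h w

  raise : ∀ {v} → IsItalianDominated E f v → IsItalianDominated E h v
  raise (inj₁ (w , a , fw≡2)) = inj₁ (w , a , ≤-antisym (h≤2 w) (h≥ fw≡2))
  raise (inj₂ (w₁ , w₂ , w₁≢w₂ , a₁ , a₂ , fw₁≡1 , fw₂≡1))
    with one-or-two (h≥ fw₁≡1) (h≤2 w₁) | one-or-two (h≥ fw₂≡1) (h≤2 w₂)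
  ... | inj₂ hw₁≡2 | _          = inj₁ (w₁ , a₁ , hw₁≡2)
  ... | inj₁ _     | inj₂ hw₂≡2 = inj₁ (w₂ , a₂ , hw₂≡2)
  ... | inj₁ hw₁≡1 | inj₁ hw₂≡1 = inj₂ (w₁ , w₂ , w₁≢w₂ , a₁ , a₂ , hw₁≡1 , hw₂≡1)

IsIDF-transport : ∀ (E E' : Digraph n) {f} → IsIDF E f →
                  (∀ x v → f x ≢ 0 → f v ≡ 0 → Arc E x v → Arc E' x v) → IsIDF E' f
IsIDF-transport E E' {f} (f≤2 , dominated) keep =
  f≤2 , λ v fv≡0 → move fv≡0 (dominated v fv≡0)
  where
  nonzero : ∀ {w m} → f w ≡ suc m → f w ≢ 0
  nonzero fw≡suc fw≡0 = contradiction (trans (sym fw≡suc) fw≡0) λ ()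

  move : ∀ {v} → f v ≡ 0 → IsItalianDominated E f v → IsItalianDominated E' f v
  move fv≡0 (inj₁ (w , a , fw≡2)) = inj₁ (w , keep _ _ (nonzero fw≡2) fv≡0 a , fw≡2)
  move fv≡0 (inj₂ (w₁ , w₂ , w₁≢w₂ , a₁ , a₂ , fw₁≡1 , fw₂≡1)) =
    inj₂ (w₁ , w₂ , w₁≢w₂ , keep _ _ (nonzero fw₁≡1) fv≡0 a₁ ,
          keep _ _ (nonzero fw₂≡1) fv≡0 a₂ , fw₁≡1 , fw₂≡1)

IsIDF-updateAt-suc : ∀ (E : Digraph n) {f} v → IsIDF E f → f v ≡ 0 → IsIDF E (updateAt f v suc)
IsIDF-updateAt-suc E {f} v fIDF fv≡0 = IsIDF-mono E fIDF below bounded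
  where
  below : ∀ u → f u ≤ updateAt f v suc u
  below u with u Fin.≟ v
  ... | yes refl = subst (_≤ updateAt f u suc u) (sym fv≡0) z≤n
  ... | no u≢v   = ≤-reflexive (sym (updateAt-minimal u v f u≢v))

  bounded : ∀ u → updateAt f v suc u ≤ 2
  bounded u with u Fin.≟ v
  ... | yes refl = subst (_≤ 2) (sym (trans (updateAt-updates u f) (cong suc fv≡0))) (s≤s z≤n)
  ... | no u≢v   = subst (_≤ 2) (sym (updateAt-minimal u v f u≢v)) (proj₁ fIDF u)

module _ (E : Digraph n) where

  IsMinIDF-weight-unique : ∀ {f f'} → IsMinIDF E f → IsMinIDF E f' → weight f ≡ weight f'
  IsMinIDF-weight-unique (fIDF , fMin) (f'IDF , f'Min) = ≤-antisym (fMin _ f'IDF) (f'Min _ fIDF)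

  IsγI-unique : ∀ {k k'} → IsγI E k → IsγI E k' → k ≡ k'
  IsγI-unique (f , fMin , refl) (f' , f'Min , refl) = IsMinIDF-weight-unique fMin f'Min

  γI≤weight : ∀ {k h} → IsγI E k → IsIDF E h → k ≤ weight h
  γI≤weight (f , (_ , fMin) , refl) hIDF = fMin _ hIDF

  -- Arc, hence IsIDF, is not decidable, so a minimum IDF exists only up to double negation.
  ¬¬-minIDF-below : ∀ b h → IsIDF E h → weight h ≤ b → ¬ ¬ ∃ (IsMinIDF E)
  ¬¬-minIDF-below b h hIDF h≤b ¬min = ¬¬-excluded-middle λ where
      (no ¬lighter) → ¬min (h , hIDF , λ h' h'IDF → ≮⇒≥ λ h'<h → ¬lighter (h' , h'IDF , h'<h))
      (yes (h' , h'IDF , h'<h)) → descend b h' h'IDF (≤-trans h'<h h≤b) ¬min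
    where
    descend : ∀ b h' → IsIDF E h' → weight h' < b → ¬ ¬ ∃ (IsMinIDF E)
    descend (suc b) h' h'IDF h'<b = ¬¬-minIDF-below b h' h'IDF (≤-pred h'<b)

  ¬¬-minIDF : ∀ h → IsIDF E h → ¬ ¬ ∃ (IsMinIDF E)
  ¬¬-minIDF h hIDF = ¬¬-minIDF-below (weight h) h hIDF ≤-refl

module ArcRemoval (D : Digraph n) {F} (okF : IsComplementArcSet D F) (p : Fin n × Fin n) where

  private
    ≢p? : ∀ q → Dec (q ≢ p)
    ≢p? q = ¬? (≡-dec Fin._≟_ Fin._≟_ q p)

  F∖p : List (Fin n × Fin n)
  F∖p = filter ≢p? F

  okF∖p : IsComplementArcSet D F∖p
  okF∖p = Unique.filter⁺ ≢p? (proj₁ okF) , All.filter⁺ ≢p? (proj₂ okF)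

  D+F D+F∖p : Digraph n
  D+F   = (D +A F) okF
  D+F∖p = (D +A F∖p) okF∖p

  length-F∖p< : p ∈ F → length F∖p < length F
  length-F∖p< p∈F = filter-notAll ≢p? F (Any.map (λ q≡p q≢p → q≢p (sym q≡p)) p∈F)

  Arc-F∖p : ∀ {x v} → (x , v) ≢ p → Arc D+F x v → Arc D+F∖p x v
  Arc-F∖p _   (inj₁ a)   = inj₁ a
  Arc-F∖p x≢p (inj₂ x∈F) = inj₂ (∈-filter⁺ ≢p? x∈F x≢p)

¬IsIRS-[] : ∀ (D : Digraph n) → ¬ IsIRS D []
¬IsIRS-[] D (ok , _ , _ , γD , (f , fMin , refl) , k'<k) =
  <⇒≱ k'<k (γI≤weight D γD (IsIDF-transport ((D +A []) ok) D (proj₁ fMin) λ where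
    _ _ _ _ (inj₁ a) → a))

IsRISet⇒shorter-IDF-weight≥ : ∀ (D : Digraph n) {F R h} → IsRISet D F → IsγI D k →
  (okR : IsComplementArcSet D R) → length R < length F →
  IsIDF ((D +A R) okR) h → k ≤ weight h
IsRISet⇒shorter-IDF-weight≥ D {R = R} {h} (_ , F-minimal) γD okR R<F hIDF =
  ≮⇒≥ λ h<k → ¬¬-minIDF ((D +A R) okR) h hIDF λ (f , fMin) →
    <⇒≱ R<F (F-minimal R (okR , _ , weight f , γD , (f , fMin , refl) ,
                          ≤-<-trans (proj₂ fMin h hIDF) h<k))

module _ (D : Digraph n) (γD : IsγI D k) {F} (rF : IsRISet D F) {g}
         (gMin : IsMinIDF ((D +A F) (proj₁ (proj₁ rF))) g) where

  private
    okF : IsComplementArcSet D F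
    okF = proj₁ (proj₁ rF)

    gIDF : IsIDF ((D +A F) okF) g
    gIDF = proj₁ gMin

  weight<γI : weight g < k
  weight<γI =
    let (_ , _ , _ , γD₀ , γDF₁ , k₁<k₀) = proj₁ rF in
    subst₂ _<_ (IsγI-unique ((D +A F) okF) γDF₁ (g , gMin , refl)) (IsγI-unique D γD₀ γD) k₁<k₀

  ¬¬-arc-active : ∀ {x v} → (x , v) ∈ F → ¬ ¬ (g x ≢ 0 × g v ≡ 0)
  ¬¬-arc-active {x} {v} xv∈F inactive =
    <⇒≱ weight<γI (IsRISet⇒shorter-IDF-weight≥ D rF γD okF∖p (length-F∖p< xv∈F) gIDF')
    where
    open ArcRemoval D okF (x , v)
    gIDF' : IsIDF D+F∖p g
    gIDF' = IsIDF-transport D+F D+F∖p gIDF λ _ _ gy≢0 gu≡0 →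
      Arc-F∖p λ { refl → inactive (gy≢0 , gu≡0) }

  arc-active : ∀ {x v} → (x , v) ∈ F → g x ≢ 0 × g v ≡ 0
  arc-active xv∈F =
    (λ gx≡0 → ¬¬-arc-active xv∈F (λ active → proj₁ active gx≡0)) ,
    decidable-stable (_ ≟ 0) (¬¬-map proj₂ (¬¬-arc-active xv∈F))

  weight+1≡γI : ∀ {x v} → (x , v) ∈ F → weight g + 1 ≡ k
  weight+1≡γI {x} {v} xv∈F = ≤-antisym (subst (_≤ k) (+-comm 1 (weight g)) weight<γI) k≤weight+1
    where
    open ArcRemoval D okF (x , v)
    g' : Fin n → ℕ
    g' = updateAt g v suc
    g'IDF : IsIDF D+F g'
    g'IDF = IsIDF-updateAt-suc D+F v gIDF (proj₂ (arc-active xv∈F))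
    g'v≢0 : g' v ≢ 0
    g'v≢0 g'v≡0 = contradiction (trans (sym (updateAt-updates v g)) g'v≡0) λ ()
    g'IDF' : IsIDF D+F∖p g'
    g'IDF' = IsIDF-transport D+F D+F∖p g'IDF λ _ _ _ g'u≡0 →
      Arc-F∖p λ { refl → g'v≢0 g'u≡0 }
    k≤weight+1 : k ≤ weight g + 1
    k≤weight+1 = subst (k ≤_) (trans (weight-updateAt-suc g v) (+-comm 1 (weight g)))
      (IsRISet⇒shorter-IDF-weight≥ D rF γD okF∖p (length-F∖p< xv∈F) g'IDF')

lemma4p1 : ∀ {n} (D : Digraph n) (k : ℕ) → IsγI D k → 3 ≤ k →
    (F : _) (rF : IsRISet D F) (g : Fin n → ℕ) →
    IsMinIDF ((D +A F) (proj₁ (proj₁ rF))) g →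
    (∀ v₁ v₂ → (v₁ , v₂) ∈ F → (g v₁ ≢ 0) × (g v₂ ≡ 0)) ×
    (weight g + 1 ≡ k)
lemma4p1 D k γD _ []      rF g gMin = contradiction (proj₁ rF) (¬IsIRS-[] D)
lemma4p1 D k γD _ (_ ∷ _) rF g gMin =
  (λ _ _ → arc-active D γD rF gMin) , weight+1≡γI D γD rF gMin (Any.here refl)
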